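{- Let $G=(V,E)$ be a strongly biconnected directed graph and let $y\in V$. Let $T$ be a spanning tree of $G$ rooted at $y$ (all edges directed away from $y$), let $G_r=(V,E_r)$ with $E_r=\{(v,w)\mid (w,v)\in E\}$ be the reverse graph, and let $T_y$ be a spanning tree of $G_r$ rooted at $y$. Initialize $E_y$ as the set of edges of $T$ together with the edges $(w,v)$ for all edges $(v,w)$ of $T_y$. Then, as long as $(V,E_y)$ is not strongly biconnected, pick an edge $(u,w)\in E\setminus E_y$ such that $u,w$ lie in distinct strongly biconnected components $C_1^B,C_2^B$ of $(V,E_y)$ with $u,w\notin C_1^B\cap C_2^B$, and add it to $E_y$. Let $E_y$ denote the final edge set when this process stops. Then no edge $e\in E\setminus E_y$ is a b-bridge of $G$.
   Context: A directed graph is strongly biconnected if it is strongly connected and its underlying undirected graph is biconnected. A strongly biconnected component of a strongly connected directed graph $H=(V,F)$ is a maximal vertex subset $U\subseteq V$ such that the subgraph of $H$ induced by $U$ is strongly biconnected. For a strongly biconnected directed graph $G=(V,E)$, an edge $e\in E$ is a b-bridge if $(V,E\setminus\{e\})$ is not strongly biconnected. -}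

module Defs where

open import Data.Nat using (ℕ)
open import Data.Fin using (Fin; _≟_)
open import Data.Fin.Subset using (Subset; _∈_; _∉_; _⊆_; ⊤; _-_)
open import Data.Bool using (Bool; true; false; _∨_; _∧_)
open import Data.Product using (Σ; ∃; _×_; _,_)
open import Data.Sum using (_⊎_)
open import Relation.Nullary using (¬_; does)
open import Relation.Binary.PropositionalEquality using (_≡_; _≢_)

-- A (simple) directed graph on vertex set Fin n, given by its edge set
-- as a Boolean adjacency relation: E u v ≡ true iff (u , v) is an edge.
EdgeSet : ℕ → Set
EdgeSet n = Fin n → Fin n → Bool

module _ {n : ℕ} where

  -- directed path from u to w all of whose vertices lie in U,
  -- using only edges of E (i.e. a path in the subgraph induced by U)
  data Path (U : Subset n) (E : EdgeSet n) : Fin n → Fin n → Set where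
    here : ∀ {v} → v ∈ U → Path U E v v
    step : ∀ {u v w} → u ∈ U → E u v ≡ true → Path U E v w → Path U E u w

  rev : EdgeSet n → EdgeSet n
  rev E u v = E v u

  undirected : EdgeSet n → EdgeSet n
  undirected E u v = E u v ∨ E v u

  removeEdge : EdgeSet n → Fin n → Fin n → EdgeSet n
  removeEdge E u w a b = E a b ∧ Data.Bool.not (does (a ≟ u) ∧ does (b ≟ w))

  addEdge : EdgeSet n → Fin n → Fin n → EdgeSet n
  addEdge E u w a b = E a b ∨ (does (a ≟ u) ∧ does (b ≟ w))

  StronglyConnectedOn : Subset n → EdgeSet n → Set
  StronglyConnectedOn U E = ∀ u v → u ∈ U → v ∈ U → Path U E u v

  BiconnectedOn : Subset n → EdgeSet n → Set
  BiconnectedOn U E =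
    (∀ u v → u ∈ U → v ∈ U → Path U (undirected E) u v) ×
    (∀ x → x ∈ U → ∀ u v → u ∈ (U - x) → v ∈ (U - x) →
       Path (U - x) (undirected E) u v)

  StronglyBiconnectedOn : Subset n → EdgeSet n → Set
  StronglyBiconnectedOn U E = StronglyConnectedOn U E × BiconnectedOn U E

  StronglyBiconnected : EdgeSet n → Set
  StronglyBiconnected E = StronglyBiconnectedOn ⊤ E

  SBComponent : EdgeSet n → Subset n → Set
  SBComponent E C =
    StronglyBiconnectedOn C E ×
    (∀ C' → C ⊆ C' → StronglyBiconnectedOn C' E → C' ⊆ C)

  BBridge : EdgeSet n → Fin n → Fin n → Set
  BBridge E u w = E u w ≡ true × ¬ StronglyBiconnected (removeEdge E u w)

  -- T is a spanning tree of (V , E) rooted at y with all edges directed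
  -- away from y (a spanning out-arborescence): T ⊆ E, y has no incoming
  -- tree edge, every other vertex has exactly one incoming tree edge,
  -- and every vertex is reachable from y in T.
  SpanningOutTree : EdgeSet n → Fin n → EdgeSet n → Set
  SpanningOutTree E y T =
    (∀ a b → T a b ≡ true → E a b ≡ true) ×
    (∀ a → T a y ≢ true) ×
    (∀ v → v ≢ y → Σ (Fin n) λ p → T p v ≡ true × (∀ q → T q v ≡ true → q ≡ p)) ×
    (∀ v → Path ⊤ T y v)

  initialEy : EdgeSet n → EdgeSet n → EdgeSet n
  initialEy T Ty a b = T a b ∨ Ty b a

  Admissible : EdgeSet n → EdgeSet n → Fin n → Fin n → Set
  Admissible E Ey u w =
    E u w ≡ true × Ey u w ≡ false ×
    Σ (Subset n) λ C₁ → Σ (Subset n) λ C₂ →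
      SBComponent Ey C₁ × SBComponent Ey C₂ × C₁ ≢ C₂ ×
      u ∈ C₁ × w ∈ C₂ ×
      ¬ (u ∈ C₁ × u ∈ C₂) × ¬ (w ∈ C₁ × w ∈ C₂)

  data Step (E : EdgeSet n) : EdgeSet n → EdgeSet n → Set where
    add : ∀ {Ey} u w → ¬ StronglyBiconnected Ey → Admissible E Ey u w →
          Step E Ey (addEdge Ey u w)

  data Steps (E : EdgeSet n) : EdgeSet n → EdgeSet n → Set where
    done : ∀ {Ey} → Steps E Ey Ey
    more : ∀ {Ey Ey' Ey''} → Step E Ey Ey' → Steps E Ey' Ey'' → Steps E Ey Ey''

  Stopped : EdgeSet n → EdgeSet n → Set
  Stopped E Ey = StronglyBiconnected Ey ⊎ (∀ u w → ¬ Admissible E Ey u w)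

-- Let (u , w) be an edge of E that is not in Ey.  Ey is a subgraph of
-- E - (u , w) which is already strongly connected, because it contains an
-- out-tree and a reversed in-tree rooted at y.  When the process stops,
-- u and w lie in a common set C that is strongly biconnected in Ey: either
-- Ey itself is strongly biconnected (C = V), or u and w lie in the same
-- strongly biconnected component, since otherwise (u , w) would still be
-- admissible.  Components exist only classically, so this is proved under
-- double negation, which suffices because the goal is a negation.
-- Inside C the endpoints u and w stay connected in the undirected Ey even
-- after deleting any third vertex; hence every undirected path of E that
-- uses (u , w) can be rerouted through C, so E - (u , w) keeps both the
-- connectivity and the biconnectivity of E.
module Submission where

open import Defs
open import Data.Nat using (ℕ; zero; suc; _<_; _+_; s≤s)
open import Data.Nat.Properties using (<⇒≱; +-suc; +-monoʳ-≤; ≤-trans; ≤-reflexive; m≤m+n)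
open import Data.Fin using (Fin; _≟_)
open import Data.Fin.Properties using (¬∀⟶∃¬)
open import Data.Fin.Subset using (Subset; _∈_; _∉_; _⊆_; _⊂_; ⊤; _-_; _─_; ⁅_⁆; ∣_∣; outside)
open import Data.Fin.Subset.Properties
  using (_∈?_; _⊆?_; ∈⊤; x∈⁅x⁆; x∈⁅y⁆⇒x≡y; p─q⊆p; x∈p∧x≢y⇒x∈p-y; p⊂q⇒∣p∣<∣q∣; ∣p∣≤n)
open import Data.Vec using (_∷_; here; there)
open import Data.Bool using (Bool; true; false; _∨_)
open import Data.Bool.Properties using (∨-comm; ∨-zeroʳ; ∧-identityʳ)
open import Data.Product using (∃; _×_; _,_; proj₁; proj₂)
open import Data.Sum using (inj₁; inj₂)
open import Data.Empty using (⊥; ⊥-elim)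
open import Relation.Nullary using (¬_; yes; no)
open import Relation.Nullary.Decidable using (_×-dec_; _→-dec_)
open import Relation.Binary.PropositionalEquality using (_≡_; _≢_; refl; sym; trans; subst)

module _ {n : ℕ} where

  infix 4 _⊆ₑ_
  _⊆ₑ_ : EdgeSet n → EdgeSet n → Set
  A ⊆ₑ B = ∀ a b → A a b ≡ true → B a b ≡ true

  ∨-introˡ : ∀ {x y : Bool} → x ≡ true → x ∨ y ≡ true
  ∨-introˡ refl = refl

  ∨-introʳ : ∀ {x y : Bool} → y ≡ true → x ∨ y ≡ true
  ∨-introʳ {x} refl = ∨-zeroʳ x

  true≢false : true ≢ false
  true≢false ()

  path-mono : ∀ {U U' : Subset n} {A B : EdgeSet n} {a b} →
    A ⊆ₑ B → U ⊆ U' → Path U A a b → Path U' B a b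
  path-mono A⊆B U⊆U' (here a∈U) = here (U⊆U' a∈U)
  path-mono A⊆B U⊆U' (step a∈U e p) = step (U⊆U' a∈U) (A⊆B _ _ e) (path-mono A⊆B U⊆U' p)

  source∈ : ∀ {U : Subset n} {A : EdgeSet n} {a b} → Path U A a b → a ∈ U
  source∈ (here a∈U) = a∈U
  source∈ (step a∈U _ _) = a∈U

  _++ₚ_ : ∀ {U : Subset n} {A : EdgeSet n} {a b c} → Path U A a b → Path U A b c → Path U A a c
  here _ ++ₚ q = q
  step a∈U e p ++ₚ q = step a∈U e (p ++ₚ q)

  snoc : ∀ {U : Subset n} {A : EdgeSet n} {a b c} → Path U A a b → A b c ≡ true → c ∈ U → Path U A a c
  snoc (here b∈U) e c∈U = step b∈U e (here c∈U)
  snoc (step a∈U e' p) e c∈U = step a∈U e' (snoc p e c∈U)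

  reverse : ∀ {U : Subset n} {A : EdgeSet n} {a b} → Path U A a b → Path U (rev A) b a
  reverse (here a∈U) = here a∈U
  reverse (step a∈U e p) = snoc (reverse p) e a∈U

  undirected-sym : (A : EdgeSet n) {U : Subset n} {a b : Fin n} →
    Path U (undirected A) a b → Path U (undirected A) b a
  undirected-sym A p = path-mono (λ a b e → trans (∨-comm (A a b) (A b a)) e) (λ z → z) (reverse p)

  undirected-mono : (A B : EdgeSet n) → A ⊆ₑ B → undirected A ⊆ₑ undirected B
  undirected-mono A B A⊆B a b e with A a b in eq
  ... | true = ∨-introˡ (A⊆B a b eq)
  ... | false = ∨-introʳ (A⊆B b a e)

  removeEdge-other : (E : EdgeSet n) {u w a b : Fin n} →
    ¬ (a ≡ u × b ≡ w) → removeEdge E u w a b ≡ E a b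
  removeEdge-other E {u} {w} {a} {b} ne with a ≟ u | b ≟ w
  ... | yes refl | yes refl = ⊥-elim (ne (refl , refl))
  ... | yes _ | no _ = ∧-identityʳ (E a b)
  ... | no _ | _ = ∧-identityʳ (E a b)

  ⊆-removeEdge : {A E : EdgeSet n} {u w : Fin n} →
    A ⊆ₑ E → A u w ≡ false → A ⊆ₑ removeEdge E u w
  ⊆-removeEdge {A} {E} {u} {w} A⊆E Auw≡false a b e with a ≟ u ×-dec b ≟ w
  ... | yes (refl , refl) = ⊥-elim (true≢false (trans (sym e) Auw≡false))
  ... | no ne = trans (removeEdge-other E ne) (A⊆E a b e)

  addEdge-⊇ : (A : EdgeSet n) (u w : Fin n) → A ⊆ₑ addEdge A u w
  addEdge-⊇ A u w a b = ∨-introˡ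

  addEdge-⊆ : {A E : EdgeSet n} {u w : Fin n} →
    A ⊆ₑ E → E u w ≡ true → addEdge A u w ⊆ₑ E
  addEdge-⊆ {A} {E} {u} {w} A⊆E Euw a b e with A a b in eq | a ≟ u | b ≟ w
  ... | true | _ | _ = A⊆E a b eq
  ... | false | yes refl | yes refl = Euw
  ... | false | yes _ | no _ = ⊥-elim (true≢false (sym e))
  ... | false | no _ | _ = ⊥-elim (true≢false (sym e))

  reroute : (E : EdgeSet n) (u w : Fin n) {U : Subset n} →
    (u ∈ U → w ∈ U → Path U (undirected (removeEdge E u w)) u w) →
    ∀ {a b} → Path U (undirected E) a b → Path U (undirected (removeEdge E u w)) a b
  reroute E u w bridge (here a∈U) = here a∈U
  reroute E u w bridge {a} (step {v = q} a∈U e p) with a ≟ u ×-dec q ≟ w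
  ... | yes (refl , refl) = bridge a∈U (source∈ p) ++ₚ reroute E u w bridge p
  ... | no ne with q ≟ u ×-dec a ≟ w
  ...   | yes (refl , refl) = undirected-sym (removeEdge E u w) (bridge (source∈ p) a∈U) ++ₚ reroute E u w bridge p
  ...   | no ne' = step a∈U kept (reroute E u w bridge p)
    where
      kept : undirected (removeEdge E u w) a q ≡ true
      kept rewrite removeEdge-other E ne | removeEdge-other E ne' = e

  ∈-─⇒∉ : ∀ {m} {p q : Subset m} {x} → x ∈ p ─ q → x ∉ q
  ∈-─⇒∉ {p = _ ∷ p} {outside ∷ q} here = λ ()
  ∈-─⇒∉ {p = _ ∷ p} {_ ∷ q} (there x∈) (there x∈q) = ∈-─⇒∉ x∈ x∈q

  ∈-x⇒≢ : ∀ {p : Subset n} {x z : Fin n} → z ∈ p - x → z ≢ x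
  ∈-x⇒≢ z∈ refl = ∈-─⇒∉ z∈ (x∈⁅x⁆ _)

  biconnected-avoiding : (A : EdgeSet n) {C : Subset n} {u w : Fin n} →
    BiconnectedOn C A → u ∈ C → w ∈ C →
    ∀ x → u ∈ ⊤ - x → w ∈ ⊤ - x → Path (⊤ - x) (undirected A) u w
  biconnected-avoiding A {C} (connected , cut) u∈C w∈C x u∉x w∉x with x ∈? C
  ... | yes x∈C = path-mono (λ _ _ e → e) C-x⊆⊤-x (cut x x∈C _ _ (restrict u∈C u∉x) (restrict w∈C w∉x))
    where
      restrict : ∀ {z} → z ∈ C → z ∈ ⊤ - x → z ∈ C - x
      restrict z∈C z∉x = x∈p∧x≢y⇒x∈p-y z∈C (∈-x⇒≢ z∉x)
      C-x⊆⊤-x : C - x ⊆ ⊤ - x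
      C-x⊆⊤-x z∈ = x∈p∧x≢y⇒x∈p-y ∈⊤ (∈-x⇒≢ z∈)
  ... | no x∉C = path-mono (λ _ _ e → e) C⊆⊤-x (connected _ _ u∈C w∈C)
    where
      C⊆⊤-x : C ⊆ ⊤ - x
      C⊆⊤-x z∈C = x∈p∧x≢y⇒x∈p-y ∈⊤ (λ z≡x → x∉C (subst (_∈ C) z≡x z∈C))

  removeEdge-stronglyBiconnected : (E Ey : EdgeSet n) {C : Subset n} {u w : Fin n} →
    StronglyBiconnected E → Ey ⊆ₑ removeEdge E u w → StronglyConnectedOn ⊤ Ey →
    BiconnectedOn C Ey → u ∈ C → w ∈ C → StronglyBiconnected (removeEdge E u w)
  removeEdge-stronglyBiconnected E Ey {u = u} {w} (_ , connected , cut) Ey⊆ scEy biC u∈C w∈C =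
    (λ a b a∈ b∈ → path-mono Ey⊆ (λ z → z) (scEy a b a∈ b∈)) ,
    (λ a b a∈ b∈ → reroute E u w (λ _ _ → lift (λ _ → ∈⊤) (proj₁ biC _ _ u∈C w∈C)) (connected a b a∈ b∈)) ,
    (λ x x∈ a b a∈ b∈ → reroute E u w (λ u∈ w∈ → lift (λ z → z) (biconnected-avoiding Ey biC u∈C w∈C x u∈ w∈))
                                 (cut x x∈ a b a∈ b∈))
    where
      lift : ∀ {U U'} {a b} → U ⊆ U' →
        Path U (undirected Ey) a b → Path U' (undirected (removeEdge E u w)) a b
      lift = path-mono (undirected-mono Ey (removeEdge E u w) Ey⊆)

  steps-⊇ : ∀ {E A B} → Steps E A B → A ⊆ₑ B
  steps-⊇ done = λ _ _ e → e
  steps-⊇ {A = A} (more (add u w _ _) rest) a b e = steps-⊇ rest a b (addEdge-⊇ A u w a b e)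

  steps-⊆ : ∀ {E A B} → A ⊆ₑ E → Steps E A B → B ⊆ₑ E
  steps-⊆ A⊆E done = A⊆E
  steps-⊆ A⊆E (more (add u w _ (Euw , _)) rest) = steps-⊆ (addEdge-⊆ A⊆E Euw) rest

  initialEy-⊆ : {E T Ty : EdgeSet n} {y : Fin n} →
    SpanningOutTree E y T → SpanningOutTree (rev E) y Ty → initialEy T Ty ⊆ₑ E
  initialEy-⊆ {T = T} (T⊆E , _) (Ty⊆revE , _) a b e with T a b in eq
  ... | true = T⊆E a b eq
  ... | false = Ty⊆revE b a e

  -- ... and strongly connected: every vertex reaches y along the reversed
  -- edges of Ty, and y reaches every vertex along T.
  initialEy-stronglyConnected : {T Ty : EdgeSet n} {y : Fin n} →
    (∀ v → Path ⊤ T y v) → (∀ v → Path ⊤ Ty y v) → StronglyConnectedOn ⊤ (initialEy T Ty)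
  initialEy-stronglyConnected reachT reachTy a b _ _ =
    path-mono (λ _ _ → ∨-introʳ) (λ z → z) (reverse (reachTy a)) ++ₚ
    path-mono (λ _ _ → ∨-introˡ) (λ z → z) (reachT b)

  -- Over a finite vertex set, p ⊈ q has an explicit witness; it shows that
  -- a proper superset is strictly larger.
  ⊈-witness : {p q : Subset n} → ¬ p ⊆ q → ∃ λ x → x ∈ p × x ∉ q
  ⊈-witness {p} {q} p⊈q
    with ¬∀⟶∃¬ n (λ x → x ∈ p → x ∈ q) (λ x → x ∈? p →-dec x ∈? q) (λ all → p⊈q (all _))
  ... | x , ¬x∈p⇒x∈q with x ∈? p
  ...   | yes x∈p = x , x∈p , λ x∈q → ¬x∈p⇒x∈q (λ _ → x∈q)
  ...   | no x∉p = ⊥-elim (¬x∈p⇒x∈q (λ x∈p → ⊥-elim (x∉p x∈p)))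

  -- A single vertex is strongly biconnected; this seeds the growth of a
  -- component around any given vertex.
  singleton-stronglyBiconnected : (A : EdgeSet n) (v : Fin n) → StronglyBiconnectedOn ⁅ v ⁆ A
  singleton-stronglyBiconnected A v = trivial , trivial , cut
    where
      trivial : ∀ {B : EdgeSet n} a b → a ∈ ⁅ v ⁆ → b ∈ ⁅ v ⁆ → Path ⁅ v ⁆ B a b
      trivial a b a∈ b∈ with x∈⁅y⁆⇒x≡y v a∈ | x∈⁅y⁆⇒x≡y v b∈
      ... | refl | refl = here a∈
      cut : ∀ x → x ∈ ⁅ v ⁆ → ∀ a b → a ∈ ⁅ v ⁆ - x → b ∈ ⁅ v ⁆ - x →
        Path (⁅ v ⁆ - x) (undirected A) a b
      cut x x∈ a b a∈ _ with x∈⁅y⁆⇒x≡y v x∈ | x∈⁅y⁆⇒x≡y v (p─q⊆p _ _ a∈)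
      ... | refl | refl = ⊥-elim (∈-─⇒∉ a∈ (x∈⁅x⁆ x))

  -- Every strongly biconnected set S extends to a component.  The fuel k
  -- bounds the number of times S can still grow: n < k + ∣ S ∣.
  extend-to-component : (A : EdgeSet n) (k : ℕ) (S : Subset n) → n < k + ∣ S ∣ →
    StronglyBiconnectedOn S A → ¬ ¬ (∃ λ C → SBComponent A C × S ⊆ C)
  extend-to-component A zero S bound sbS _ = <⇒≱ bound (∣p∣≤n S)
  extend-to-component A (suc k) S bound sbS noComponent =
    noComponent (S , (sbS , maximal) , λ z → z)
    where
      maximal : ∀ C' → S ⊆ C' → StronglyBiconnectedOn C' A → C' ⊆ S
      maximal C' S⊆C' sbC' with C' ⊆? S
      ... | yes C'⊆S = C'⊆S
      ... | no C'⊈S = ⊥-elim (extend-to-component A k C' bound' sbC'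
                        λ (C , compC , C'⊆C) → noComponent (C , compC , λ z → C'⊆C (S⊆C' z)))
        where
          S⊂C' : S ⊂ C'
          S⊂C' = S⊆C' , ⊈-witness C'⊈S
          bound' : n < k + ∣ C' ∣
          bound' = ≤-trans bound (≤-trans (≤-reflexive (sym (+-suc k ∣ S ∣)))
                                          (+-monoʳ-≤ k (p⊂q⇒∣p∣<∣q∣ S⊂C')))

  component-of : (A : EdgeSet n) (v : Fin n) → ¬ ¬ (∃ λ C → SBComponent A C × v ∈ C)
  component-of A v noComponent =
    extend-to-component A (suc n) ⁅ v ⁆ (s≤s (m≤m+n n _)) (singleton-stronglyBiconnected A v)
      λ (C , compC , v⊆C) → noComponent (C , compC , v⊆C (x∈⁅x⁆ v))

  -- When the process has stopped, the endpoints of an edge of E that was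
  -- not added lie in a common strongly biconnected set of Ey: otherwise
  -- the edge would join two distinct components and still be admissible.
  stopped-common-set : {E Ey : EdgeSet n} {u w : Fin n} →
    E u w ≡ true → Ey u w ≡ false → Stopped E Ey →
    ¬ ¬ (∃ λ C → StronglyBiconnectedOn C Ey × u ∈ C × w ∈ C)
  stopped-common-set Euw Eyuw (inj₁ sbEy) noSet = noSet (⊤ , sbEy , ∈⊤ , ∈⊤)
  stopped-common-set {E} {Ey} {u} {w} Euw Eyuw (inj₂ noAdmissible) noSet =
    component-of Ey u λ (Cu , compCu , u∈Cu) →
    component-of Ey w λ (Cw , compCw , w∈Cw) → separate Cu compCu u∈Cu Cw compCw w∈Cw
    where
      separate : ∀ Cu → SBComponent Ey Cu → u ∈ Cu → ∀ Cw → SBComponent Ey Cw → w ∈ Cw → ⊥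
      separate Cu compCu u∈Cu Cw compCw w∈Cw with w ∈? Cu | u ∈? Cw
      ... | yes w∈Cu | _ = noSet (Cu , proj₁ compCu , u∈Cu , w∈Cu)
      ... | no _ | yes u∈Cw = noSet (Cw , proj₁ compCw , u∈Cw , w∈Cw)
      ... | no w∉Cu | no u∉Cw =
        noAdmissible u w (Euw , Eyuw , Cu , Cw , compCu , compCw ,
          (λ Cu≡Cw → u∉Cw (subst (u ∈_) Cu≡Cw u∈Cu)) , u∈Cu , w∈Cw ,
          (λ both → u∉Cw (proj₂ both)) , (λ both → w∉Cu (proj₁ both)))

lemma3 : {n : ℕ} (E : EdgeSet n) (y : Fin n) (T Ty Ey : EdgeSet n) →
    StronglyBiconnected E →
    SpanningOutTree E y T →
    SpanningOutTree (rev E) y Ty →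
    Steps E (initialEy T Ty) Ey →
    Stopped E Ey →
    ∀ u w → E u w ≡ true → Ey u w ≡ false → ¬ BBridge E u w
lemma3 E y T Ty Ey sbE treeT treeTy steps stop u w Euw Eyuw (_ , notSB) =
  stopped-common-set Euw Eyuw stop λ (C , (_ , biC) , u∈C , w∈C) →
    notSB (removeEdge-stronglyBiconnected E Ey sbE Ey⊆E-uw scEy biC u∈C w∈C)
  where
    Ey⊆E-uw : Ey ⊆ₑ removeEdge E u w
    Ey⊆E-uw = ⊆-removeEdge (steps-⊆ (initialEy-⊆ treeT treeTy) steps) Eyuw
    scEy : StronglyConnectedOn ⊤ Ey
    scEy a b a∈ b∈ = path-mono (steps-⊇ steps) (λ z → z)
      (initialEy-stronglyConnected (proj₂ (proj₂ (proj₂ treeT))) (proj₂ (proj₂ (proj₂ treeTy))) a b a∈ b∈)
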